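{- Let $m,i,j$ be positive integers, $q=2^m$, $Q_1=2^i$, $Q_2=2^j$, and let $\mu_{q+1}=\{x\in\mathbb{F}_{q^2}: x^{q+1}=1\}$. Let $H_A(x)=x^{Q_1+Q_2}+x^{Q_1+1}+x^{Q_2+1}+x+1$, $H_B(x)=x^{Q_1+Q_2}+x^{Q_1+1}+x^{Q_1}+x^{Q_2+1}+1$, $H_C(x)=x^{Q_1+Q_2+1}+x^{Q_1}+x^{Q_2}+x+1$. Then: (i) $H_A(x)$ has no roots in $\mu_{q+1}$ if and only if $ij\equiv1\pmod 2$ or $m$ is even; (ii) $H_B(x)$ has no roots in $\mu_{q+1}$ if and only if $i(j+1)\equiv 1\pmod 2$ or $m$ is even; (iii) $H_C(x)$ has no roots in $\mu_{q+1}$ if and only if $(1+i)(1+j)\equiv 1\pmod 2$ or $m$ is even. -}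

module Defs where

open import Level using (Level; suc; _⊔_)
open import Data.Nat as ℕ using (ℕ)
open import Data.Fin using (Fin)
open import Data.Product using (∃; _×_)
open import Relation.Nullary using (¬_)
open import Algebra.Bundles using (CommutativeRing; Semiring)
open import Function.Bundles using (Bijection)
import Relation.Binary.PropositionalEquality as ≡
import Algebra.Definitions.RawSemiring as RS

-- Since 2 ^ n elements forces
-- characteristic 2, we also record 1 + 1 ≈ 0 explicitly (implied, not extra).
record FiniteField2 (n : ℕ) (c ℓ : Level) : Set (suc (c ⊔ ℓ)) where
  field
    commRing : CommutativeRing c ℓ
  open CommutativeRing commRing public
  field
    0≉1        : ¬ (0# ≈ 1#)
    inverse    : ∀ x → ¬ (x ≈ 0#) → ∃ λ y → x * y ≈ 1#
    char2      : 1# + 1# ≈ 0#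
    card       : Bijection (≡.setoid (Fin (2 ℕ.^ n))) setoid
  open RS (Semiring.rawSemiring semiring) public using () renaming (_^_ to _^ᶠ_)

  μ : ℕ → Carrier → Set ℓ
  μ m x = x ^ᶠ (2 ℕ.^ m ℕ.+ 1) ≈ 1#

  NoRootInμ : ℕ → (Carrier → Carrier) → Set (c ⊔ ℓ)
  NoRootInμ m H = ¬ (∃ λ x → μ m x × H x ≈ 0#)

  H-A H-B H-C : ℕ → ℕ → Carrier → Carrier
  H-A i j x = let Q₁ = 2 ℕ.^ i ; Q₂ = 2 ℕ.^ j in
    x ^ᶠ (Q₁ ℕ.+ Q₂) + x ^ᶠ (Q₁ ℕ.+ 1) + x ^ᶠ (Q₂ ℕ.+ 1) + x + 1#
  H-B i j x = let Q₁ = 2 ℕ.^ i ; Q₂ = 2 ℕ.^ j in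
    x ^ᶠ (Q₁ ℕ.+ Q₂) + x ^ᶠ (Q₁ ℕ.+ 1) + x ^ᶠ Q₁ + x ^ᶠ (Q₂ ℕ.+ 1) + 1#
  H-C i j x = let Q₁ = 2 ℕ.^ i ; Q₂ = 2 ℕ.^ j in
    x ^ᶠ (Q₁ ℕ.+ Q₂ ℕ.+ 1) + x ^ᶠ Q₁ + x ^ᶠ Q₂ + x + 1#

-- A root x of H on the unit circle μ_{q+1} satisfies x ^ q = 1 / x, so the
-- Frobenius y ↦ y ^ q turns H(x) = 0 into a second equation in 1 / x,
-- x ^ (-Q₁) and x ^ (-Q₂). A combination of the two equations is
-- L · (x² + x + 1) with L linear in x ^ Q₁ and x ^ Q₂, and L = 0 forces
-- x ^ Q₁ to be a root of t² + t + 1; either way x is a primitive cube root of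
-- unity ω. As ω ^ (2 ^ k) is ω or ω² = ω + 1 according to the parity of k,
-- ω lies on μ_{q+1} exactly when m is odd, and H(ω) vanishes exactly when the
-- stated parity fails. Such an ω exists in F_{4^m}: otherwise x ↦ 1 / (1 + x)
-- would split F ∖ {0, 1} into orbits of length 3, but 3 ∤ 4^m − 2.

module Submission where

open import Algebra.Bundles using (CommutativeRing)
open import Data.Empty using (⊥-elim)
open import Data.Fin using (Fin)
import Data.Fin.Properties as Fin
open import Data.List using (List; []; _∷_; length; filter; allFin)
open import Data.List.Membership.Propositional using (_∈_)
open import Data.List.Membership.Propositional.Properties using (∈-filter⁺; ∈-filter⁻; ∈-allFin)
open import Data.List.Properties using (filter-accept; filter-reject; filter-all; length-tabulate)
open import Data.List.Relation.Unary.All as All using ()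
open import Data.List.Relation.Unary.AllPairs using (_∷_)
open import Data.List.Relation.Unary.Any using (here; there)
open import Data.List.Relation.Unary.Unique.Propositional using (Unique)
import Data.List.Relation.Unary.Unique.Propositional.Properties as Unique
open import Data.Nat as ℕ using (ℕ; zero; suc; _≤_; s≤s; _%_)
open import Data.Nat.Divisibility using (_∣_; _∣0; ∣-refl; ∣m∣n⇒∣m+n; ∣m+n∣m⇒∣n; m∣m*n; ∣1⇒≡1)
open import Data.Nat.DivMod using ([m+n]%n≡m%n)
import Data.Nat.Properties as ℕ
open import Data.Product using (∃; _×_; _,_; proj₁; proj₂)
open import Data.Sum using (_⊎_; inj₁; inj₂; [_,_]′)
open import Defs
open import Function using (_∘_; id; case_of_)
open import Function.Bundles using (Bijection; Equivalence; _⇔_; mk⇔)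
open import Level using (Level)
open import Relation.Binary.Definitions using (DecidableEquality)
open import Relation.Binary.PropositionalEquality as ≡ using (_≡_; _≢_)
open import Relation.Nullary using (¬_; Dec; yes; no; ¬?)

[2+n]%2≡n%2 : ∀ n → (2 ℕ.+ n) % 2 ≡ n % 2
[2+n]%2≡n%2 n = ≡.trans (≡.cong (_% 2) (ℕ.+-comm 2 n)) ([m+n]%n≡m%n n 2)

even-or-odd : ∀ n → (n % 2 ≡ 0 × suc n % 2 ≡ 1) ⊎ (n % 2 ≡ 1 × suc n % 2 ≡ 0)
even-or-odd zero          = inj₁ (≡.refl , ≡.refl)
even-or-odd (suc zero)    = inj₂ (≡.refl , ≡.refl)
even-or-odd (suc (suc n)) rewrite [2+n]%2≡n%2 n | [2+n]%2≡n%2 (suc n) = even-or-odd n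

3∣2+4^m : ∀ m → 3 ∣ 2 ℕ.+ 4 ℕ.^ m
3∣2+4^m zero    = ∣-refl
3∣2+4^m (suc m) = ≡.subst (3 ∣_) (split (4 ℕ.^ m)) (∣m∣n⇒∣m+n (m∣m*n (4 ℕ.^ m)) (3∣2+4^m m))
  where
  open import Data.Nat.Solver using (module +-*-Solver)
  open +-*-Solver
  split : ∀ a → 3 ℕ.* a ℕ.+ (2 ℕ.+ a) ≡ 2 ℕ.+ 4 ℕ.* a
  split = solve 1 (λ a → con 3 :* a :+ (con 2 :+ a) := con 2 :+ con 4 :* a) ≡.refl

3∤1+2^[2m] : ∀ m → ¬ 3 ∣ 1 ℕ.+ 2 ℕ.^ (2 ℕ.* m)
3∤1+2^[2m] m 3∣1+2^[2m] = case ∣1⇒≡1 (∣m+n∣m⇒∣n 3∣[1+4^m]+1 3∣1+4^m) of λ ()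
  where
  3∣1+4^m : 3 ∣ 1 ℕ.+ 4 ℕ.^ m
  3∣1+4^m = ≡.subst (λ k → 3 ∣ 1 ℕ.+ k) (≡.sym (ℕ.^-*-assoc 2 2 m)) 3∣1+2^[2m]
  3∣[1+4^m]+1 : 3 ∣ (1 ℕ.+ 4 ℕ.^ m) ℕ.+ 1
  3∣[1+4^m]+1 = ≡.subst (3 ∣_) (ℕ.+-comm 1 (1 ℕ.+ 4 ℕ.^ m)) (3∣2+4^m m)

module _ {a} {A : Set a} (_≟_ : DecidableEquality A) where

  open ≡ using (refl; sym; trans; cong; subst; module ≡-Reasoning)

  _≢?_ : ∀ x y → Dec (x ≢ y)
  x ≢? y = ¬? (x ≟ y)

  remove : A → List A → List A
  remove x = filter (_≢? x)

  ∈-remove⁺ : ∀ {x y xs} → y ∈ xs → y ≢ x → y ∈ remove x xs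
  ∈-remove⁺ {x} = ∈-filter⁺ (_≢? x)

  ∈-remove⁻ : ∀ {x y} xs → y ∈ remove x xs → y ∈ xs
  ∈-remove⁻ {x} xs y∈ = proj₁ (∈-filter⁻ (_≢? x) {xs = xs} y∈)

  ∈-remove⇒≢ : ∀ {x y} xs → y ∈ remove x xs → y ≢ x
  ∈-remove⇒≢ {x} xs y∈ = proj₂ (∈-filter⁻ (_≢? x) {xs = xs} y∈)

  remove-unique : ∀ {x xs} → Unique xs → Unique (remove x xs)
  remove-unique {x} = Unique.filter⁺ (_≢? x)

  length-remove : ∀ {x xs} → Unique xs → x ∈ xs → length xs ≡ suc (length (remove x xs))
  length-remove {x} {x ∷ ys} (x∉ys ∷ _) (here refl) = cong (suc ∘ length) (sym (begin
    remove x (x ∷ ys)  ≡⟨ filter-reject (_≢? x) (λ x≢x → x≢x refl) ⟩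
    remove x ys        ≡⟨ filter-all (_≢? x) (All.map (λ x≢y → x≢y ∘ sym) x∉ys) ⟩
    ys                 ∎))
    where open ≡-Reasoning
  length-remove {x} {y ∷ ys} (y∉ys ∷ u) (there x∈ys) = begin
    suc (length ys)                   ≡⟨ cong suc (length-remove u x∈ys) ⟩
    suc (suc (length (remove x ys)))
      ≡⟨ cong (suc ∘ length) (filter-accept (_≢? x) (All.lookup y∉ys x∈ys)) ⟨
    suc (length (remove x (y ∷ ys)))  ∎
    where open ≡-Reasoning

  module _ (σ : A → A) where

    free-order-3⇒3∣length : ∀ {xs} → Unique xs →
      (∀ {x} → x ∈ xs → σ x ∈ xs) → (∀ {x} → x ∈ xs → σ (σ (σ x)) ≡ x) →
      (∀ {x} → x ∈ xs → σ x ≢ x) → 3 ∣ length xs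
    free-order-3⇒3∣length {xs} = go (length xs) ℕ.≤-refl
      where
      go : ∀ n {xs} → length xs ≤ n → Unique xs →
        (∀ {x} → x ∈ xs → σ x ∈ xs) → (∀ {x} → x ∈ xs → σ (σ (σ x)) ≡ x) →
        (∀ {x} → x ∈ xs → σ x ≢ x) → 3 ∣ length xs
      go _ {[]} _ _ _ _ _ = 3 ∣0
      go (suc n) {x ∷ xs} (s≤s |xs|≤n) u closed cyc free =
        subst (3 ∣_) (sym |x∷xs|≡3+|zs|)
          (∣m∣n⇒∣m+n ∣-refl (go n |zs|≤n zs-unique zs-closed (cyc ∘ ∈zs⇒∈) (free ∘ ∈zs⇒∈)))
        where
        x∈ : x ∈ x ∷ xs
        x∈ = here refl
        σ-injective : ∀ {y z} → y ∈ x ∷ xs → z ∈ x ∷ xs → σ y ≡ σ z → y ≡ z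
        σ-injective y∈ z∈ eq = trans (sym (cyc y∈)) (trans (cong (σ ∘ σ) eq) (cyc z∈))
        σx≢x : σ x ≢ x
        σx≢x = free x∈
        σσx≢σx : σ (σ x) ≢ σ x
        σσx≢σx = free (closed x∈)
        σσx≢x : σ (σ x) ≢ x
        σσx≢x eq = σx≢x (trans (sym (cong σ eq)) (cyc x∈))
        ys ys′ zs : List A
        ys = remove x (x ∷ xs)
        ys′ = remove (σ x) ys
        zs = remove (σ (σ x)) ys′
        ∈zs⇒∈ : ∀ {y} → y ∈ zs → y ∈ x ∷ xs
        ∈zs⇒∈ = ∈-remove⁻ (x ∷ xs) ∘ ∈-remove⁻ ys ∘ ∈-remove⁻ ys′
        zs-unique : Unique zs
        zs-unique = remove-unique (remove-unique (remove-unique u))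
        |x∷xs|≡3+|zs| : length (x ∷ xs) ≡ 3 ℕ.+ length zs
        |x∷xs|≡3+|zs| = trans (length-remove u x∈)
          (cong suc (trans (length-remove (remove-unique u) (∈-remove⁺ (closed x∈) σx≢x))
          (cong suc (length-remove (remove-unique (remove-unique u))
            (∈-remove⁺ (∈-remove⁺ (closed (closed x∈)) σσx≢x) σσx≢σx)))))
        |zs|≤n : length zs ≤ n
        |zs|≤n = ℕ.m+n≤o⇒n≤o 2 (ℕ.≤-pred (subst (_≤ suc n) |x∷xs|≡3+|zs| (s≤s |xs|≤n)))
        zs-closed : ∀ {y} → y ∈ zs → σ y ∈ zs
        zs-closed {y} y∈zs = ∈-remove⁺ (∈-remove⁺ (∈-remove⁺ (closed y∈) σy≢x) σy≢σx) σy≢σσx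
          where
          y∈ : y ∈ x ∷ xs
          y∈ = ∈zs⇒∈ y∈zs
          y≢σσx : y ≢ σ (σ x)
          y≢σσx = ∈-remove⇒≢ ys′ y∈zs
          y≢σx : y ≢ σ x
          y≢σx = ∈-remove⇒≢ ys (∈-remove⁻ ys′ y∈zs)
          y≢x : y ≢ x
          y≢x = ∈-remove⇒≢ (x ∷ xs) (∈-remove⁻ ys (∈-remove⁻ ys′ y∈zs))
          σy≢x : σ y ≢ x
          σy≢x eq = y≢σσx (trans (sym (cyc y∈)) (cong (σ ∘ σ) eq))
          σy≢σx : σ y ≢ σ x
          σy≢σx = y≢x ∘ σ-injective y∈ x∈
          σy≢σσx : σ y ≢ σ (σ x)
          σy≢σσx = y≢σx ∘ σ-injective y∈ (closed x∈)

module CommutativeRingProperties {c ℓ} (R : CommutativeRing c ℓ) where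

  open CommutativeRing R
  open import Algebra.Properties.Semiring.Exp semiring using (_^_; ^-homo-*; ^-congʳ)
  import Algebra.Properties.Semiring.Mult semiring as Mult
  open import Relation.Binary.Reasoning.Setoid setoid

  infixl 6 _+₀_
  infixl 7 _*₀_

  _+₀_ : ∀ {a b} → a ≈ 0# → b ≈ 0# → a + b ≈ 0#
  a≈0 +₀ b≈0 = trans (+-cong a≈0 b≈0) (+-identityʳ 0#)

  _*₀_ : ∀ a {b} → b ≈ 0# → a * b ≈ 0#
  a *₀ b≈0 = trans (*-congˡ b≈0) (zeroʳ a)

  inverse-unique : ∀ {u v w} → u * v ≈ 1# → u * w ≈ 1# → v ≈ w
  inverse-unique {u} {v} {w} uv≈1 uw≈1 = begin
    v            ≈⟨ *-identityʳ v ⟨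
    v * 1#       ≈⟨ *-congˡ uw≈1 ⟨
    v * (u * w)  ≈⟨ *-assoc v u w ⟨
    v * u * w    ≈⟨ *-congʳ (trans (*-comm v u) uv≈1) ⟩
    1# * w       ≈⟨ *-identityˡ w ⟩
    w            ∎

  unit-cancel : ∀ {u v z} → u * v ≈ 1# → u * z ≈ 0# → z ≈ 0#
  unit-cancel {u} {v} {z} uv≈1 uz≈0 = begin
    z            ≈⟨ *-identityˡ z ⟨
    1# * z       ≈⟨ *-congʳ (trans (*-comm v u) uv≈1) ⟨
    v * u * z    ≈⟨ *-assoc v u z ⟩
    v * (u * z)  ≈⟨ v *₀ uz≈0 ⟩
    0#           ∎

  fromℕ : ℕ → Carrier
  fromℕ k = k Mult.× 1#

  fromℕ-* : ∀ m n → fromℕ (m ℕ.* n) ≈ fromℕ m * fromℕ n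
  fromℕ-* = Mult.×1-homo-*

  ^-+1 : ∀ x k → x ^ (k ℕ.+ 1) ≈ x ^ k * x
  ^-+1 x k = trans (^-homo-* x k 1) (*-congˡ (*-identityʳ x))

  ^-double : ∀ x k → x ^ (2 ℕ.* k) ≈ x ^ k * x ^ k
  ^-double x k = trans (^-congʳ x (≡.cong (k ℕ.+_) (ℕ.+-identityʳ k))) (^-homo-* x k k)

  1^k≈1 : ∀ k → 1# ^ k ≈ 1#
  1^k≈1 zero    = refl
  1^k≈1 (suc k) = trans (*-identityˡ _) (1^k≈1 k)

  0^n≈0 : ∀ n .{{_ : ℕ.NonZero n}} → 0# ^ n ≈ 0#
  0^n≈0 (suc n) = zeroˡ _

  module CharacteristicTwo (char2 : 1# + 1# ≈ 0#) where

    open import Algebra.Solver.Ring.NaturalCoefficients.Default commutativeSemiring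
    open import Algebra.Properties.CommutativeSemiring.Exp commutativeSemiring using (^-distrib-*)

    -- Identities of characteristic 2 are checked by the ring solver as
    -- characteristic-free identities up to multiples of 2.
    cancel-doubles : ∀ {s t} p → s + (1# + 1#) * p ≈ t → s ≈ t
    cancel-doubles {s} {t} p eq = begin
      s                   ≈⟨ +-identityʳ s ⟨
      s + 0#              ≈⟨ +-congˡ (trans (*-congʳ char2) (zeroˡ p)) ⟨
      s + (1# + 1#) * p   ≈⟨ eq ⟩
      t                   ∎

    x+x≈0 : ∀ x → x + x ≈ 0#
    x+x≈0 x = sym (cancel-doubles x (solve 1 (λ x → con 0 :+ con 2 :* x := x :+ x) refl x))

    x+y≈0⇒x≈y : ∀ {x y} → x + y ≈ 0# → x ≈ y
    x+y≈0⇒x≈y {x} {y} x+y≈0 = begin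
      x             ≈⟨ +-identityʳ x ⟨
      x + 0#        ≈⟨ +-congˡ (x+x≈0 y) ⟨
      x + (y + y)   ≈⟨ +-assoc x y y ⟨
      x + y + y     ≈⟨ +-congʳ x+y≈0 ⟩
      0# + y        ≈⟨ +-identityˡ y ⟩
      y             ∎

    x≈y⇒x+y≈0 : ∀ {x y} → x ≈ y → x + y ≈ 0#
    x≈y⇒x+y≈0 {x} {y} x≈y = trans (+-congʳ x≈y) (x+x≈0 y)

    x+[x+y]≈y : ∀ x y → x + (x + y) ≈ y
    x+[x+y]≈y x y = trans (sym (+-assoc x x y)) (trans (+-congʳ (x+x≈0 x)) (+-identityˡ y))

    [x+y]²≈x²+y² : ∀ x y → (x + y) * (x + y) ≈ x * x + y * y
    [x+y]²≈x²+y² x y = sym (cancel-doubles (x * y)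
      (solve 2 (λ x y → x :* x :+ y :* y :+ con 2 :* (x :* y) := (x :+ y) :* (x :+ y)) refl x y))

    frobenius-+ : ∀ k x y → (x + y) ^ (2 ℕ.^ k) ≈ x ^ (2 ℕ.^ k) + y ^ (2 ℕ.^ k)
    frobenius-+ zero    x y = trans (*-identityʳ (x + y)) (sym (+-cong (*-identityʳ x) (*-identityʳ y)))
    frobenius-+ (suc k) x y = begin
      (x + y) ^ (2 ℕ.* K)                   ≈⟨ ^-double (x + y) K ⟩
      (x + y) ^ K * (x + y) ^ K             ≈⟨ *-cong (frobenius-+ k x y) (frobenius-+ k x y) ⟩
      (x ^ K + y ^ K) * (x ^ K + y ^ K)     ≈⟨ [x+y]²≈x²+y² (x ^ K) (y ^ K) ⟩
      x ^ K * x ^ K + y ^ K * y ^ K         ≈⟨ +-cong (^-double x K) (^-double y K) ⟨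
      x ^ (2 ℕ.* K) + y ^ (2 ℕ.* K)         ∎
      where
      K : ℕ
      K = 2 ℕ.^ k

    Ω : Carrier → Carrier
    Ω x = x * x + x + 1#

    Ω-cong : ∀ {x y} → x ≈ y → Ω x ≈ Ω y
    Ω-cong x≈y = +-congʳ (+-cong (*-cong x≈y x≈y) x≈y)

    Ω-frobenius : ∀ k x → Ω x ^ (2 ℕ.^ k) ≈ Ω (x ^ (2 ℕ.^ k))
    Ω-frobenius k x = begin
      (x * x + x + 1#) ^ K                 ≈⟨ frobenius-+ k (x * x + x) 1# ⟩
      (x * x + x) ^ K + 1# ^ K             ≈⟨ +-cong (frobenius-+ k (x * x) x) (1^k≈1 K) ⟩
      (x * x) ^ K + x ^ K + 1#             ≈⟨ +-congʳ (+-congʳ (^-distrib-* x x K)) ⟩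
      x ^ K * x ^ K + x ^ K + 1#           ∎
      where
      K : ℕ
      K = 2 ℕ.^ k

    cube-root-square : ∀ {ω} → Ω ω ≈ 0# → ω * ω ≈ ω + 1#
    cube-root-square {ω} Ωω≈0 = begin
      ω * ω
        ≈⟨ cancel-doubles (ω + 1#)
             (solve 1 (λ ω →
                  ω :* ω :+ con 2 :* (ω :+ con 1)
                := ω :+ con 1 :+ (ω :* ω :+ ω :+ con 1)
                ) refl ω) ⟩
      ω + 1# + Ω ω      ≈⟨ +-congˡ Ωω≈0 ⟩
      ω + 1# + 0#       ≈⟨ +-identityʳ _ ⟩
      ω + 1#            ∎

    cube-root-unit : ∀ {ω} → Ω ω ≈ 0# → ω * (ω + 1#) ≈ 1#
    cube-root-unit {ω} Ωω≈0 = begin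
      ω * (ω + 1#)      ≈⟨ distribˡ ω ω 1# ⟩
      ω * ω + ω * 1#    ≈⟨ +-cong (cube-root-square Ωω≈0) (*-identityʳ ω) ⟩
      ω + 1# + ω        ≈⟨ +-comm (ω + 1#) ω ⟩
      ω + (ω + 1#)      ≈⟨ x+[x+y]≈y ω 1# ⟩
      1#                ∎

    fromℕ-idempotent : ∀ k → fromℕ k * fromℕ k ≈ fromℕ k
    fromℕ-idempotent zero    = zeroˡ 0#
    fromℕ-idempotent (suc k) =
      trans ([x+y]²≈x²+y² 1# (fromℕ k)) (+-cong (*-identityˡ 1#) (fromℕ-idempotent k))

    -- In characteristic 2, fromℕ k is 0 or 1 according to the parity of k.
    cube-root-frobenius : ∀ {ω} → Ω ω ≈ 0# → ∀ k → ω ^ (2 ℕ.^ k) ≈ ω + fromℕ k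
    cube-root-frobenius {ω} Ωω≈0 zero    = trans (*-identityʳ ω) (sym (+-identityʳ ω))
    cube-root-frobenius {ω} Ωω≈0 (suc k) = begin
      ω ^ (2 ℕ.* K)                  ≈⟨ ^-double ω K ⟩
      ω ^ K * ω ^ K                  ≈⟨ *-cong ω^K≈ω+k ω^K≈ω+k ⟩
      (ω + fromℕ k) * (ω + fromℕ k)  ≈⟨ [x+y]²≈x²+y² ω (fromℕ k) ⟩
      ω * ω + fromℕ k * fromℕ k      ≈⟨ +-cong (cube-root-square Ωω≈0) (fromℕ-idempotent k) ⟩
      ω + 1# + fromℕ k               ≈⟨ +-assoc ω 1# (fromℕ k) ⟩
      ω + fromℕ (suc k)              ∎
      where
      K : ℕ
      K = 2 ℕ.^ k
      ω^K≈ω+k : ω ^ K ≈ ω + fromℕ k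
      ω^K≈ω+k = cube-root-frobenius Ωω≈0 k

    cube-root-shift : ∀ {ω} → Ω ω ≈ 0# → ∀ k → ω + ω ^ (2 ℕ.^ k) ≈ fromℕ k
    cube-root-shift {ω} Ωω≈0 k = trans (+-congˡ (cube-root-frobenius Ωω≈0 k)) (x+[x+y]≈y ω (fromℕ k))

    cube-root-^[2^m+1] : ∀ {ω} → Ω ω ≈ 0# → ∀ m →
                         ω ^ (2 ℕ.^ m ℕ.+ 1) ≈ 1# + fromℕ (suc m) * ω
    cube-root-^[2^m+1] {ω} Ωω≈0 m = begin
      ω ^ (2 ℕ.^ m ℕ.+ 1)             ≈⟨ ^-+1 ω (2 ℕ.^ m) ⟩
      ω ^ (2 ℕ.^ m) * ω               ≈⟨ *-congʳ (cube-root-frobenius Ωω≈0 m) ⟩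
      (ω + e) * ω
        ≈⟨ cancel-doubles (ω + 1#)
             (solve 2 (λ ω e →
                  (ω :+ e) :* ω :+ con 2 :* (ω :+ con 1)
                := con 1 :+ (con 1 :+ e) :* ω :+ (ω :* ω :+ ω :+ con 1)
                ) refl ω e) ⟩
      1# + (1# + e) * ω + Ω ω         ≈⟨ +-congˡ Ωω≈0 ⟩
      1# + (1# + e) * ω + 0#          ≈⟨ +-identityʳ _ ⟩
      1# + (1# + e) * ω               ∎
      where
      e : Carrier
      e = fromℕ m

    -- x ↦ 1 / (1 + x) has order 3 and its fixed points are the roots of Ω.
    möbius-order-3 : ∀ {x y z w} →
      (1# + x) * y ≈ 1# → (1# + y) * z ≈ 1# → (1# + z) * w ≈ 1# → w ≈ x
    möbius-order-3 {x} {y} {z} {w} xy yz zw = inverse-unique zw (trans (*-comm (1# + z) x) x[1+z]≈1)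
      where
      x[1+z]≈1 : x * (1# + z) ≈ 1#
      x[1+z]≈1 = x+y≈0⇒x≈y (begin
        x * (1# + z) + 1#
          ≈⟨ cancel-doubles (x * y * z + y * z + z)
               (solve 3 (λ x y z →
                    x :* (con 1 :+ z) :+ con 1 :+ con 2 :* (x :* y :* z :+ y :* z :+ z)
                  := z :* ((con 1 :+ x) :* y :+ con 1)
                     :+ (x :+ con 1) :* ((con 1 :+ y) :* z :+ con 1)
                  ) refl x y z) ⟩
        z * ((1# + x) * y + 1#) + (x + 1#) * ((1# + y) * z + 1#)
          ≈⟨ z *₀ x≈y⇒x+y≈0 xy +₀ (x + 1#) *₀ x≈y⇒x+y≈0 yz ⟩
        0# ∎)

    möbius-fixed-point : ∀ {x} → (1# + x) * x ≈ 1# → Ω x ≈ 0#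
    möbius-fixed-point {x} x²+x≈1 = begin
      Ω x                 ≈⟨ solve 1 (λ x → x :* x :+ x :+ con 1 := (con 1 :+ x) :* x :+ con 1) refl x ⟩
      (1# + x) * x + 1#   ≈⟨ x≈y⇒x+y≈0 x²+x≈1 ⟩
      0#                  ∎

    -- H-A, H-B and H-C with x ^ Q₁ and x ^ Q₂ replaced by variables a and b.
    hA hB hC : Carrier → Carrier → Carrier → Carrier
    hA x a b = a * b + a * x + b * x + x + 1#
    hB x a b = a * b + a * x + a + b * x + 1#
    hC x a b = a * b * x + a + b + x + 1#

    module _ (k : ℕ) where

      private
        K : ℕ
        K = 2 ℕ.^ k
        φ-+ : ∀ x y → (x + y) ^ K ≈ x ^ K + y ^ K
        φ-+ = frobenius-+ k
        φ-* : ∀ x y → (x * y) ^ K ≈ x ^ K * y ^ K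
        φ-* x y = ^-distrib-* x y K

      hA-frobenius : ∀ x a b → hA x a b ^ K ≈ hA (x ^ K) (a ^ K) (b ^ K)
      hA-frobenius x a b = trans (φ-+ _ _) (+-cong (trans (φ-+ _ _) (+-cong (trans (φ-+ _ _)
        (+-cong (trans (φ-+ _ _) (+-cong (φ-* a b) (φ-* a x))) (φ-* b x))) refl)) (1^k≈1 K))

      hB-frobenius : ∀ x a b → hB x a b ^ K ≈ hB (x ^ K) (a ^ K) (b ^ K)
      hB-frobenius x a b = trans (φ-+ _ _) (+-cong (trans (φ-+ _ _) (+-cong (trans (φ-+ _ _)
        (+-cong (trans (φ-+ _ _) (+-cong (φ-* a b) (φ-* a x))) refl)) (φ-* b x))) (1^k≈1 K))

      hC-frobenius : ∀ x a b → hC x a b ^ K ≈ hC (x ^ K) (a ^ K) (b ^ K)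
      hC-frobenius x a b = trans (φ-+ _ _) (+-cong (trans (φ-+ _ _) (+-cong (trans (φ-+ _ _)
        (+-cong (trans (φ-+ _ _) (+-cong (trans (φ-* (a * b) x) (*-congʳ (φ-* a b))) refl)) refl)) refl))
        (1^k≈1 K))

    -- At a root ω of Ω the polynomials factor through the shifts ω + ω ^ Q ∈ {0, 1}.
    hA-at-cube-root : ∀ {ω} → Ω ω ≈ 0# → ∀ i j →
                      hA ω (ω ^ (2 ℕ.^ i)) (ω ^ (2 ℕ.^ j)) ≈ fromℕ (i ℕ.* j)
    hA-at-cube-root {ω} Ωω≈0 i j = begin
      hA ω a b
        ≈⟨ cancel-doubles (ω * ω)
             (solve 3 (λ ω a b →
                  (a :* b :+ a :* ω :+ b :* ω :+ ω :+ con 1) :+ con 2 :* (ω :* ω)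
                := (ω :+ a) :* (ω :+ b) :+ (ω :* ω :+ ω :+ con 1)
                ) refl ω a b) ⟩
      (ω + a) * (ω + b) + Ω ω     ≈⟨ +-cong (*-cong (shift i) (shift j)) Ωω≈0 ⟩
      fromℕ i * fromℕ j + 0#      ≈⟨ +-identityʳ _ ⟩
      fromℕ i * fromℕ j           ≈⟨ fromℕ-* i j ⟨
      fromℕ (i ℕ.* j)             ∎
      where
      a b : Carrier
      a = ω ^ (2 ℕ.^ i)
      b = ω ^ (2 ℕ.^ j)
      shift : ∀ k → ω + ω ^ (2 ℕ.^ k) ≈ fromℕ k
      shift = cube-root-shift Ωω≈0

    hB-at-cube-root : ∀ {ω} → Ω ω ≈ 0# → ∀ i j →
                      hB ω (ω ^ (2 ℕ.^ i)) (ω ^ (2 ℕ.^ j)) ≈ fromℕ (i ℕ.* (j ℕ.+ 1))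
    hB-at-cube-root {ω} Ωω≈0 i j = begin
      hB ω a b
        ≈⟨ cancel-doubles (ω * ω + ω)
             (solve 3 (λ ω a b →
                  (a :* b :+ a :* ω :+ a :+ b :* ω :+ con 1) :+ con 2 :* (ω :* ω :+ ω)
                := (ω :+ a) :* (con 1 :+ (ω :+ b)) :+ (ω :* ω :+ ω :+ con 1)
                ) refl ω a b) ⟩
      (ω + a) * (1# + (ω + b)) + Ω ω    ≈⟨ +-cong (*-cong (shift i) (+-congˡ (shift j))) Ωω≈0 ⟩
      fromℕ i * fromℕ (suc j) + 0#      ≈⟨ +-identityʳ _ ⟩
      fromℕ i * fromℕ (suc j)           ≈⟨ fromℕ-* i (suc j) ⟨
      fromℕ (i ℕ.* suc j)               ≡⟨ ≡.cong (λ k → fromℕ (i ℕ.* k)) (ℕ.+-comm 1 j) ⟩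
      fromℕ (i ℕ.* (j ℕ.+ 1))           ∎
      where
      a b : Carrier
      a = ω ^ (2 ℕ.^ i)
      b = ω ^ (2 ℕ.^ j)
      shift : ∀ k → ω + ω ^ (2 ℕ.^ k) ≈ fromℕ k
      shift = cube-root-shift Ωω≈0

    hC-at-cube-root : ∀ {ω} → Ω ω ≈ 0# → ∀ i j →
                      hC ω (ω ^ (2 ℕ.^ i)) (ω ^ (2 ℕ.^ j)) ≈ ω * fromℕ ((1 ℕ.+ i) ℕ.* (1 ℕ.+ j))
    hC-at-cube-root {ω} Ωω≈0 i j = begin
      hC ω a b
        ≈⟨ cancel-doubles (a * ω * ω + b * ω * ω + ω * ω * ω + a * ω + b * ω + ω * ω + ω * ω + ω)
             (solve 3 (λ ω a b →
                  (a :* b :* ω :+ a :+ b :+ ω :+ con 1)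
                  :+ con 2 :* (a :* ω :* ω :+ b :* ω :* ω :+ ω :* ω :* ω :+ a :* ω :+ b :* ω
                             :+ ω :* ω :+ ω :* ω :+ ω)
                := ω :* (con 1 :+ (ω :+ a)) :* (con 1 :+ (ω :+ b))
                   :+ (ω :+ a :+ b :+ con 1) :* (ω :* ω :+ ω :+ con 1)
                ) refl ω a b) ⟩
      ω * (1# + (ω + a)) * (1# + (ω + b)) + (ω + a + b + 1#) * Ω ω
        ≈⟨ +-cong (*-cong (*-congˡ (+-congˡ (shift i))) (+-congˡ (shift j))) (_ *₀ Ωω≈0) ⟩
      ω * fromℕ (suc i) * fromℕ (suc j) + 0#
        ≈⟨ +-identityʳ _ ⟩
      ω * fromℕ (suc i) * fromℕ (suc j)
        ≈⟨ *-assoc ω _ _ ⟩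
      ω * (fromℕ (suc i) * fromℕ (suc j))
        ≈⟨ *-congˡ (fromℕ-* (suc i) (suc j)) ⟨
      ω * fromℕ ((1 ℕ.+ i) ℕ.* (1 ℕ.+ j))
        ∎
      where
      a b : Carrier
      a = ω ^ (2 ℕ.^ i)
      b = ω ^ (2 ℕ.^ j)
      shift : ∀ k → ω + ω ^ (2 ℕ.^ k) ≈ fromℕ k
      shift = cube-root-shift Ωω≈0

    hA-conjugate : ∀ {x y a a' b b'} → x * y ≈ 1# → a * a' ≈ 1# → b * b' ≈ 1# →
                   hA x a b ≈ 0# → hA y a' b' ≈ 0# → (a + b + 1#) * Ω x ≈ 0#
    hA-conjugate {x} {y} {a} {a'} {b} {b'} xy≈1 aa'≈1 bb'≈1 h≈0 h'≈0 = begin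
      (a + b + 1#) * Ω x
        ≈⟨ cancel-doubles (a * a' * b * b' * x + a * a' * b * x * y + a * b * b' * x * y
                            + a * b * x * y + a * a' * b + a * b * b' + a * b * x + b * b' * x
                            + a * b + x)
             (solve 6 (λ x y a a' b b' →
                  (a :+ b :+ con 1) :* (x :* x :+ x :+ con 1)
                  :+ con 2 :* (a :* a' :* b :* b' :* x :+ a :* a' :* b :* x :* y
                             :+ a :* b :* b' :* x :* y :+ a :* b :* x :* y :+ a :* a' :* b
                             :+ a :* b :* b' :+ a :* b :* x :+ b :* b' :* x :+ a :* b :+ x)
                := (con 1 :+ x) :* (a :* b :+ a :* x :+ b :* x :+ x :+ con 1)
                   :+ x :* a :* b :* (a' :* b' :+ a' :* y :+ b' :* y :+ y :+ con 1)
                   :+ (a :* a' :* b :+ a :* b :* b' :+ a :* b) :* (x :* y :+ con 1)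
                   :+ (b :* b' :* x :+ b) :* (a :* a' :+ con 1) :+ (a :+ x) :* (b :* b' :+ con 1)
                ) refl x y a a' b b') ⟩
      (1# + x) * hA x a b + x * a * b * hA y a' b'
        + (a * a' * b + a * b * b' + a * b) * (x * y + 1#)
        + (b * b' * x + b) * (a * a' + 1#) + (a + x) * (b * b' + 1#)
        ≈⟨ _ *₀ h≈0 +₀ _ *₀ h'≈0 +₀ _ *₀ x≈y⇒x+y≈0 xy≈1
             +₀ _ *₀ x≈y⇒x+y≈0 aa'≈1 +₀ _ *₀ x≈y⇒x+y≈0 bb'≈1 ⟩
      0# ∎

    hB-conjugate : ∀ {x y a a' b b'} → x * y ≈ 1# → a * a' ≈ 1# → b * b' ≈ 1# →
                   hB x a b ≈ 0# → hB y a' b' ≈ 0# → (a + b) * Ω x ≈ 0#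
    hB-conjugate {x} {y} {a} {a'} {b} {b'} xy≈1 aa'≈1 bb'≈1 h≈0 h'≈0 = begin
      (a + b) * Ω x
        ≈⟨ cancel-doubles (a * a' * b * b' * x + a * a' * b * x * y + a * b * b' * x * y
                            + a * a' * b * x + a * a' * b + a * b * b' + a * b * x + b * b' * x + x)
             (solve 6 (λ x y a a' b b' →
                  (a :+ b) :* (x :* x :+ x :+ con 1)
                  :+ con 2 :* (a :* a' :* b :* b' :* x :+ a :* a' :* b :* x :* y
                             :+ a :* b :* b' :* x :* y :+ a :* a' :* b :* x :+ a :* a' :* b
                             :+ a :* b :* b' :+ a :* b :* x :+ b :* b' :* x :+ x)
                := x :* (a :* b :+ a :* x :+ a :+ b :* x :+ con 1)
                   :+ x :* a :* b :* (a' :* b' :+ a' :* y :+ a' :+ b' :* y :+ con 1)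
                   :+ (a :* a' :* b :+ a :* b :* b') :* (x :* y :+ con 1)
                   :+ (b :* b' :* x :+ b :* x :+ b) :* (a :* a' :+ con 1)
                   :+ (a :+ x) :* (b :* b' :+ con 1)
                ) refl x y a a' b b') ⟩
      x * hB x a b + x * a * b * hB y a' b'
        + (a * a' * b + a * b * b') * (x * y + 1#)
        + (b * b' * x + b * x + b) * (a * a' + 1#) + (a + x) * (b * b' + 1#)
        ≈⟨ _ *₀ h≈0 +₀ _ *₀ h'≈0 +₀ _ *₀ x≈y⇒x+y≈0 xy≈1
             +₀ _ *₀ x≈y⇒x+y≈0 aa'≈1 +₀ _ *₀ x≈y⇒x+y≈0 bb'≈1 ⟩
      0# ∎

    hC-conjugate : ∀ {x y a a' b b'} → x * y ≈ 1# → a * a' ≈ 1# → b * b' ≈ 1# →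
                   hC x a b ≈ 0# → hC y a' b' ≈ 0# → (a + b + 1#) * Ω x ≈ 0#
    hC-conjugate {x} {y} {a} {a'} {b} {b'} xy≈1 aa'≈1 bb'≈1 h≈0 h'≈0 = begin
      (a + b + 1#) * Ω x
        ≈⟨ cancel-doubles (a * a' * b * b' * x * x * y + a * a' * b * b' * x + a * a' * b * x * x
                            + a * b * b' * x * x + a * b * x * x * y + a * b * x * x + a * b * x
                            + b * b' * x + x)
             (solve 6 (λ x y a a' b b' →
                  (a :+ b :+ con 1) :* (x :* x :+ x :+ con 1)
                  :+ con 2 :* (a :* a' :* b :* b' :* x :* x :* y :+ a :* a' :* b :* b' :* x
                             :+ a :* a' :* b :* x :* x :+ a :* b :* b' :* x :* x
                             :+ a :* b :* x :* x :* y :+ a :* b :* x :* x :+ a :* b :* x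
                             :+ b :* b' :* x :+ x)
                := (con 1 :+ x) :* (a :* b :* x :+ a :+ b :+ x :+ con 1)
                   :+ x :* x :* a :* b :* (a' :* b' :* y :+ a' :+ b' :+ y :+ con 1)
                   :+ (a :* a' :* b :* b' :* x :+ a :* b :* x) :* (x :* y :+ con 1)
                   :+ (b :* b' :* x :+ b :* x :* x) :* (a :* a' :+ con 1)
                   :+ (a :* x :* x :+ x) :* (b :* b' :+ con 1)
                ) refl x y a a' b b') ⟩
      (1# + x) * hC x a b + x * x * a * b * hC y a' b'
        + (a * a' * b * b' * x + a * b * x) * (x * y + 1#)
        + (b * b' * x + b * x * x) * (a * a' + 1#) + (a * x * x + x) * (b * b' + 1#)
        ≈⟨ _ *₀ h≈0 +₀ _ *₀ h'≈0 +₀ _ *₀ x≈y⇒x+y≈0 xy≈1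
             +₀ _ *₀ x≈y⇒x+y≈0 aa'≈1 +₀ _ *₀ x≈y⇒x+y≈0 bb'≈1 ⟩
      0# ∎

    hA-branch : ∀ {x a b} → hA x a b ≈ 0# → a + b + 1# ≈ 0# → Ω a ≈ 0#
    hA-branch {x} {a} {b} h≈0 L≈0 = begin
      Ω a
        ≈⟨ cancel-doubles (a * b + a * x + b * x + x)
             (solve 3 (λ x a b →
                  (a :* a :+ a :+ con 1) :+ con 2 :* (a :* b :+ a :* x :+ b :* x :+ x)
                := (a :* b :+ a :* x :+ b :* x :+ x :+ con 1) :+ (x :+ a) :* (a :+ b :+ con 1)
                ) refl x a b) ⟩
      hA x a b + (x + a) * (a + b + 1#)   ≈⟨ h≈0 +₀ _ *₀ L≈0 ⟩
      0#                                  ∎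

    hB-branch : ∀ {x a b} → hB x a b ≈ 0# → a + b ≈ 0# → Ω a ≈ 0#
    hB-branch {x} {a} {b} h≈0 L≈0 = begin
      Ω a
        ≈⟨ cancel-doubles (a * b + a * x + b * x)
             (solve 3 (λ x a b →
                  (a :* a :+ a :+ con 1) :+ con 2 :* (a :* b :+ a :* x :+ b :* x)
                := (a :* b :+ a :* x :+ a :+ b :* x :+ con 1) :+ (x :+ a) :* (a :+ b)
                ) refl x a b) ⟩
      hB x a b + (x + a) * (a + b)        ≈⟨ h≈0 +₀ _ *₀ L≈0 ⟩
      0#                                  ∎

    hC-branch : ∀ {x y a b} → x * y ≈ 1# → hC x a b ≈ 0# → a + b + 1# ≈ 0# → Ω a ≈ 0#
    hC-branch {x} {y} {a} {b} xy≈1 h≈0 L≈0 = unit-cancel xy≈1 (begin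
      x * Ω a
        ≈⟨ cancel-doubles (a * b * x + a + b + 1#)
             (solve 3 (λ x a b →
                  x :* (a :* a :+ a :+ con 1) :+ con 2 :* (a :* b :* x :+ a :+ b :+ con 1)
                := (a :* b :* x :+ a :+ b :+ x :+ con 1) :+ (x :* a :+ con 1) :* (a :+ b :+ con 1)
                ) refl x a b) ⟩
      hC x a b + (x * a + 1#) * (a + b + 1#)    ≈⟨ h≈0 +₀ _ *₀ L≈0 ⟩
      0#                                        ∎)

module Field {c ℓ n} (F : FiniteField2 n c ℓ) where

  open FiniteField2 F
  open CommutativeRingProperties commRing
  open CharacteristicTwo char2
  open import Algebra.Properties.AbelianGroup +-abelianGroup using (identityʳ-unique)
  open import Algebra.Properties.CommutativeSemiring.Exp commutativeSemiring using (^-distrib-*)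
  open import Algebra.Properties.Semiring.Exp semiring using (^-congˡ; ^-congʳ; ^-assocʳ; ^-homo-*)
  open import Relation.Binary.Reasoning.Setoid setoid
  private module card = Bijection card

  index : Carrier → Fin (2 ℕ.^ n)
  index x = proj₁ (card.surjective x)

  to-index : ∀ x → card.to (index x) ≈ x
  to-index x = proj₂ (card.surjective x) ≡.refl

  ≉⇒≢index : ∀ {k x} → ¬ card.to k ≈ x → k ≢ index x
  ≉⇒≢index {k} {x} k≉x k≡ix = k≉x (trans (card.cong k≡ix) (to-index x))

  ≢index⇒≉ : ∀ {k x} → k ≢ index x → ¬ card.to k ≈ x
  ≢index⇒≉ {k} {x} k≢ix k≈x = k≢ix (card.injective (trans k≈x (sym (to-index x))))

  _≟_ : ∀ x y → Dec (x ≈ y)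
  x ≟ y with index x Fin.≟ index y
  ... | yes ix≡iy = yes (trans (sym (to-index x)) (trans (card.cong ix≡iy) (to-index y)))
  ... | no  ix≢iy = no (≢index⇒≉ ix≢iy ∘ trans (to-index x))

  x*y≈0⇒x≈0⊎y≈0 : ∀ {x y} → x * y ≈ 0# → x ≈ 0# ⊎ y ≈ 0#
  x*y≈0⇒x≈0⊎y≈0 {x} xy≈0 with x ≟ 0#
  ... | yes x≈0 = inj₁ x≈0
  ... | no  x≉0 = inj₂ (unit-cancel (proj₂ (inverse x x≉0)) xy≈0)

  x^k≈0⇒x≈0 : ∀ {x} k → x ^ᶠ k ≈ 0# → x ≈ 0#
  x^k≈0⇒x≈0 zero    1≈0     = ⊥-elim (0≉1 (sym 1≈0))
  x^k≈0⇒x≈0 (suc k) x^k+1≈0 = [ id , x^k≈0⇒x≈0 k ]′ (x*y≈0⇒x≈0⊎y≈0 x^k+1≈0)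

  fromℕ≈0⇔%2≡0 : ∀ k → fromℕ k ≈ 0# ⇔ k % 2 ≡ 0
  fromℕ≈0⇔%2≡0 zero          = mk⇔ (λ _ → ≡.refl) (λ _ → refl)
  fromℕ≈0⇔%2≡0 (suc zero)    = mk⇔ (⊥-elim ∘ 0≉1 ∘ sym ∘ trans (sym (+-identityʳ 1#))) λ ()
  fromℕ≈0⇔%2≡0 (suc (suc k)) = mk⇔
    (≡.trans ([2+n]%2≡n%2 k) ∘ to (fromℕ≈0⇔%2≡0 k) ∘ trans (sym (x+[x+y]≈y 1# (fromℕ k))))
    (trans (x+[x+y]≈y 1# (fromℕ k)) ∘ from (fromℕ≈0⇔%2≡0 k) ∘ ≡.trans (≡.sym ([2+n]%2≡n%2 k)))
    where open Equivalence

  -- The value at 1 is junk.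
  möbius : Carrier → Carrier
  möbius x with x ≟ 1#
  ... | yes _   = 1#
  ... | no  x≉1 = proj₁ (inverse (1# + x) (x≉1 ∘ sym ∘ x+y≈0⇒x≈y))

  möbius-inverse : ∀ {x} → ¬ x ≈ 1# → (1# + x) * möbius x ≈ 1#
  möbius-inverse {x} x≉1 with x ≟ 1#
  ... | yes x≈1 = ⊥-elim (x≉1 x≈1)
  ... | no  _   = proj₂ (inverse (1# + x) _)

  module _ (no-cube-root : ∀ x → ¬ Ω x ≈ 0#) where

    private
      N : ℕ
      N = 2 ℕ.^ n
      to : Fin N → Carrier
      to = card.to

      σ : Fin N → Fin N
      σ k = index (möbius (to k))

      others : List (Fin N)
      others = remove Fin._≟_ (index 1#) (remove Fin._≟_ (index 0#) (allFin N))

      ∈others : ∀ {k} → ¬ to k ≈ 0# → ¬ to k ≈ 1# → k ∈ others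
      ∈others k≉0 k≉1 =
        ∈-remove⁺ Fin._≟_ (∈-remove⁺ Fin._≟_ (∈-allFin _) (≉⇒≢index k≉0)) (≉⇒≢index k≉1)

      others-≉0 : ∀ {k} → k ∈ others → ¬ to k ≈ 0#
      others-≉0 k∈ = ≢index⇒≉ (∈-remove⇒≢ Fin._≟_ (allFin N) (∈-remove⁻ Fin._≟_ _ k∈))

      others-≉1 : ∀ {k} → k ∈ others → ¬ to k ≈ 1#
      others-≉1 k∈ = ≢index⇒≉ (∈-remove⇒≢ Fin._≟_ (remove Fin._≟_ (index 0#) (allFin N)) k∈)

      σ-inverse : ∀ {k} → k ∈ others → (1# + to k) * to (σ k) ≈ 1#
      σ-inverse k∈ = trans (*-congˡ (to-index _)) (möbius-inverse (others-≉1 k∈))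

      σ-closed : ∀ {k} → k ∈ others → σ k ∈ others
      σ-closed {k} k∈ = ∈others σk≉0 σk≉1
        where
        σk≉0 : ¬ to (σ k) ≈ 0#
        σk≉0 σk≈0 = 0≉1 (trans (sym ((1# + to k) *₀ σk≈0)) (σ-inverse k∈))
        σk≉1 : ¬ to (σ k) ≈ 1#
        σk≉1 σk≈1 = others-≉0 k∈ (identityʳ-unique 1# (to k)
          (trans (sym (*-identityʳ _)) (trans (*-congˡ (sym σk≈1)) (σ-inverse k∈))))

      σ-order-3 : ∀ {k} → k ∈ others → σ (σ (σ k)) ≡ k
      σ-order-3 k∈ = card.injective
        (möbius-order-3 (σ-inverse k∈) (σ-inverse (σ-closed k∈)) (σ-inverse (σ-closed (σ-closed k∈))))

      σ-fixed-point-free : ∀ {k} → k ∈ others → σ k ≢ k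
      σ-fixed-point-free {k} k∈ σk≡k =
        no-cube-root (to k) (möbius-fixed-point (trans (*-congˡ (sym (card.cong σk≡k))) (σ-inverse k∈)))

      N≡2+|others| : N ≡ 2 ℕ.+ length others
      N≡2+|others| = ≡.trans (≡.sym (length-tabulate id))
        (≡.trans (length-remove Fin._≟_ (Unique.allFin⁺ N) (∈-allFin _))
          (≡.cong suc (length-remove Fin._≟_ (remove-unique Fin._≟_ (Unique.allFin⁺ N))
            (∈-remove⁺ Fin._≟_ (∈-allFin _) (≉⇒≢index (0≉1 ∘ sym ∘ trans (sym (to-index 1#))))))))

    no-cube-root⇒3∣1+2^n : 3 ∣ 1 ℕ.+ 2 ℕ.^ n
    no-cube-root⇒3∣1+2^n = ≡.subst (3 ∣_) (≡.cong suc (≡.sym N≡2+|others|))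
      (∣m∣n⇒∣m+n ∣-refl (free-order-3⇒3∣length Fin._≟_ σ
        (remove-unique Fin._≟_ (remove-unique Fin._≟_ (Unique.allFin⁺ N)))
        σ-closed σ-order-3 σ-fixed-point-free))

  cube-root-of-unity : ¬ 3 ∣ 1 ℕ.+ 2 ℕ.^ n → ∃ λ ω → Ω ω ≈ 0#
  cube-root-of-unity 3∤1+2^n with Fin.any? (λ k → Ω (card.to k) ≟ 0#)
  ... | yes (k , Ωk≈0) = card.to k , Ωk≈0
  ... | no  ∄k         = ⊥-elim (3∤1+2^n (no-cube-root⇒3∣1+2^n
    (λ x Ωx≈0 → ∄k (index x , trans (Ω-cong (to-index x)) Ωx≈0))))

  μ⇒x*x^q≈1 : ∀ m {x} → μ m x → x * x ^ᶠ (2 ℕ.^ m) ≈ 1#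
  μ⇒x*x^q≈1 m {x} μx = trans (*-comm x _) (trans (sym (^-+1 x (2 ℕ.^ m))) μx)

  μ⇒x^k*[x^k]^q≈1 : ∀ m {x} → μ m x → ∀ k → x ^ᶠ k * (x ^ᶠ k) ^ᶠ (2 ℕ.^ m) ≈ 1#
  μ⇒x^k*[x^k]^q≈1 m {x} μx k = begin
    x ^ᶠ k * (x ^ᶠ k) ^ᶠ q      ≈⟨ *-congˡ (^-assocʳ x k q) ⟩
    x ^ᶠ k * x ^ᶠ (k ℕ.* q)     ≈⟨ *-congˡ (^-congʳ x (ℕ.*-comm k q)) ⟩
    x ^ᶠ k * x ^ᶠ (q ℕ.* k)     ≈⟨ *-congˡ (^-assocʳ x q k) ⟨
    x ^ᶠ k * (x ^ᶠ q) ^ᶠ k      ≈⟨ ^-distrib-* x (x ^ᶠ q) k ⟨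
    (x * x ^ᶠ q) ^ᶠ k           ≈⟨ ^-congˡ k (μ⇒x*x^q≈1 m μx) ⟩
    1# ^ᶠ k                     ≈⟨ 1^k≈1 k ⟩
    1#                          ∎
    where
    q : ℕ
    q = 2 ℕ.^ m

  root-in-μ⇒cube-root :
    (h : Carrier → Carrier → Carrier → Carrier) (L : Carrier → Carrier → Carrier) →
    (∀ k x a b → h x a b ^ᶠ (2 ℕ.^ k) ≈ h (x ^ᶠ (2 ℕ.^ k)) (a ^ᶠ (2 ℕ.^ k)) (b ^ᶠ (2 ℕ.^ k))) →
    (∀ {x y a a' b b'} → x * y ≈ 1# → a * a' ≈ 1# → b * b' ≈ 1# →
      h x a b ≈ 0# → h y a' b' ≈ 0# → L a b * Ω x ≈ 0#) →
    (∀ {x y a b} → x * y ≈ 1# → h x a b ≈ 0# → L a b ≈ 0# → Ω a ≈ 0#) →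
    ∀ m i j {x} → μ m x → h x (x ^ᶠ (2 ℕ.^ i)) (x ^ᶠ (2 ℕ.^ j)) ≈ 0# → Ω x ≈ 0#
  root-in-μ⇒cube-root h L h-frobenius h-conjugate h-branch m i j {x} μx h≈0 =
    [ (λ L≈0 → x^k≈0⇒x≈0 (2 ℕ.^ i) (trans (Ω-frobenius i x) (h-branch x*x^q≈1 h≈0 L≈0))) , id ]′
      (x*y≈0⇒x≈0⊎y≈0 (h-conjugate x*x^q≈1
        (μ⇒x^k*[x^k]^q≈1 m μx (2 ℕ.^ i)) (μ⇒x^k*[x^k]^q≈1 m μx (2 ℕ.^ j)) h≈0 h^q≈0))
    where
    q : ℕ
    q = 2 ℕ.^ m
    a b : Carrier
    a = x ^ᶠ (2 ℕ.^ i)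
    b = x ^ᶠ (2 ℕ.^ j)
    x*x^q≈1 : x * x ^ᶠ q ≈ 1#
    x*x^q≈1 = μ⇒x*x^q≈1 m μx
    h^q≈0 : h (x ^ᶠ q) (a ^ᶠ q) (b ^ᶠ q) ≈ 0#
    h^q≈0 = trans (sym (h-frobenius m x a b)) (trans (^-congˡ q h≈0) (0^n≈0 q {{ℕ.m^n≢0 2 m}}))

  H-A≈hA : ∀ i j x → H-A i j x ≈ hA x (x ^ᶠ (2 ℕ.^ i)) (x ^ᶠ (2 ℕ.^ j))
  H-A≈hA i j x = +-congʳ (+-congʳ (+-cong
    (+-cong (^-homo-* x (2 ℕ.^ i) (2 ℕ.^ j)) (^-+1 x (2 ℕ.^ i))) (^-+1 x (2 ℕ.^ j))))

  H-B≈hB : ∀ i j x → H-B i j x ≈ hB x (x ^ᶠ (2 ℕ.^ i)) (x ^ᶠ (2 ℕ.^ j))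
  H-B≈hB i j x = +-congʳ (+-cong
    (+-congʳ (+-cong (^-homo-* x (2 ℕ.^ i) (2 ℕ.^ j)) (^-+1 x (2 ℕ.^ i)))) (^-+1 x (2 ℕ.^ j)))

  H-C≈hC : ∀ i j x → H-C i j x ≈ hC x (x ^ᶠ (2 ℕ.^ i)) (x ^ᶠ (2 ℕ.^ j))
  H-C≈hC i j x = +-congʳ (+-congʳ (+-congʳ (+-congʳ
    (trans (^-+1 x (2 ℕ.^ i ℕ.+ 2 ℕ.^ j)) (*-congʳ (^-homo-* x (2 ℕ.^ i) (2 ℕ.^ j)))))))

  H-A-root⇒cube-root : ∀ m i j {x} → μ m x → H-A i j x ≈ 0# → Ω x ≈ 0#
  H-A-root⇒cube-root m i j {x} μx H≈0 = root-in-μ⇒cube-root hA (λ a b → a + b + 1#)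
    hA-frobenius hA-conjugate (λ _ → hA-branch) m i j μx (trans (sym (H-A≈hA i j x)) H≈0)

  H-B-root⇒cube-root : ∀ m i j {x} → μ m x → H-B i j x ≈ 0# → Ω x ≈ 0#
  H-B-root⇒cube-root m i j {x} μx H≈0 = root-in-μ⇒cube-root hB _+_
    hB-frobenius hB-conjugate (λ _ → hB-branch) m i j μx (trans (sym (H-B≈hB i j x)) H≈0)

  H-C-root⇒cube-root : ∀ m i j {x} → μ m x → H-C i j x ≈ 0# → Ω x ≈ 0#
  H-C-root⇒cube-root m i j {x} μx H≈0 = root-in-μ⇒cube-root hC (λ a b → a + b + 1#)
    hC-frobenius hC-conjugate hC-branch m i j μx (trans (sym (H-C≈hC i j x)) H≈0)

  H-A≈0-at-cube-root : ∀ i j {ω} → Ω ω ≈ 0# → H-A i j ω ≈ 0# ⇔ fromℕ (i ℕ.* j) ≈ 0#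
  H-A≈0-at-cube-root i j {ω} Ωω≈0 = mk⇔ (trans (sym H≈k)) (trans H≈k)
    where
    H≈k : H-A i j ω ≈ fromℕ (i ℕ.* j)
    H≈k = trans (H-A≈hA i j ω) (hA-at-cube-root Ωω≈0 i j)

  H-B≈0-at-cube-root : ∀ i j {ω} → Ω ω ≈ 0# → H-B i j ω ≈ 0# ⇔ fromℕ (i ℕ.* (j ℕ.+ 1)) ≈ 0#
  H-B≈0-at-cube-root i j {ω} Ωω≈0 = mk⇔ (trans (sym H≈k)) (trans H≈k)
    where
    H≈k : H-B i j ω ≈ fromℕ (i ℕ.* (j ℕ.+ 1))
    H≈k = trans (H-B≈hB i j ω) (hB-at-cube-root Ωω≈0 i j)

  H-C≈0-at-cube-root : ∀ i j {ω} → Ω ω ≈ 0# →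
                       H-C i j ω ≈ 0# ⇔ fromℕ ((1 ℕ.+ i) ℕ.* (1 ℕ.+ j)) ≈ 0#
  H-C≈0-at-cube-root i j {ω} Ωω≈0 =
    mk⇔ (unit-cancel (cube-root-unit Ωω≈0) ∘ trans (sym H≈ωk)) (trans H≈ωk ∘ (ω *₀_))
    where
    H≈ωk : H-C i j ω ≈ ω * fromℕ ((1 ℕ.+ i) ℕ.* (1 ℕ.+ j))
    H≈ωk = trans (H-C≈hC i j ω) (hC-at-cube-root Ωω≈0 i j)

  cube-root∈μ⇔ : ∀ m {ω} → Ω ω ≈ 0# → μ m ω ⇔ fromℕ (suc m) ≈ 0#
  cube-root∈μ⇔ m {ω} Ωω≈0 = mk⇔
    (λ μω → unit-cancel (cube-root-unit Ωω≈0)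
      (trans (*-comm ω _) (identityʳ-unique 1# _ (trans (sym (cube-root-^[2^m+1] Ωω≈0 m)) μω))))
    (λ e≈0 → trans (cube-root-^[2^m+1] Ωω≈0 m)
      (trans (+-congˡ (trans (*-congʳ e≈0) (zeroˡ ω))) (+-identityʳ 1#)))

  no-root-criterion : ∀ m (H : Carrier → Carrier) k → ¬ 3 ∣ 1 ℕ.+ 2 ℕ.^ n →
    (∀ {x} → μ m x → H x ≈ 0# → Ω x ≈ 0#) →
    (∀ {ω} → Ω ω ≈ 0# → H ω ≈ 0# ⇔ fromℕ k ≈ 0#) →
    NoRootInμ m H ⇔ (k % 2 ≡ 1 ⊎ m % 2 ≡ 0)
  no-root-criterion m H k 3∤1+2^n root⇒cube-root at-cube-root = mk⇔ necessary sufficient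
    where
    open Equivalence
    necessary : NoRootInμ m H → k % 2 ≡ 1 ⊎ m % 2 ≡ 0
    necessary no-root with even-or-odd k | even-or-odd m | cube-root-of-unity 3∤1+2^n
    ... | inj₂ (k-odd , _)  | _                   | _        = inj₁ k-odd
    ... | inj₁ _            | inj₁ (m-even , _)   | _        = inj₂ m-even
    ... | inj₁ (k-even , _) | inj₂ (_ , 1+m-even) | ω , Ωω≈0 = ⊥-elim (no-root (ω , μω , Hω≈0))
      where
      μω : μ m ω
      μω = from (cube-root∈μ⇔ m Ωω≈0) (from (fromℕ≈0⇔%2≡0 (suc m)) 1+m-even)
      Hω≈0 : H ω ≈ 0#
      Hω≈0 = from (at-cube-root Ωω≈0) (from (fromℕ≈0⇔%2≡0 k) k-even)
    root-parities : ∀ {x} → μ m x → H x ≈ 0# → k % 2 ≡ 0 × suc m % 2 ≡ 0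
    root-parities {x} μx Hx≈0 =
        to (fromℕ≈0⇔%2≡0 k) (to (at-cube-root Ωx≈0) Hx≈0)
      , to (fromℕ≈0⇔%2≡0 (suc m)) (to (cube-root∈μ⇔ m Ωx≈0) μx)
      where
      Ωx≈0 : Ω x ≈ 0#
      Ωx≈0 = root⇒cube-root μx Hx≈0
    sufficient : k % 2 ≡ 1 ⊎ m % 2 ≡ 0 → NoRootInμ m H
    sufficient parity (x , μx , Hx≈0) with root-parities μx Hx≈0 | parity | even-or-odd m
    ... | k-even , _   | inj₁ k-odd  | _                  = ℕ.0≢1+n (≡.trans (≡.sym k-even) k-odd)
    ... | _ , 1+m-even | inj₂ m-even | inj₁ (_ , 1+m-odd) = ℕ.0≢1+n (≡.trans (≡.sym 1+m-even) 1+m-odd)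
    ... | _            | inj₂ m-even | inj₂ (m-odd , _)   = ℕ.0≢1+n (≡.trans (≡.sym m-even) m-odd)

open import Data.Nat using (_+_; _*_; _^_; _<_)

lemma3p2 : ∀ {c ℓ : Level} (m i j : ℕ) → 0 < m → 0 < i → 0 < j →
    (F : FiniteField2 (2 * m) c ℓ) →
    (FiniteField2.NoRootInμ F m (FiniteField2.H-A F i j) ⇔ ((i * j) % 2 ≡ 1 ⊎ m % 2 ≡ 0))
    × (FiniteField2.NoRootInμ F m (FiniteField2.H-B F i j) ⇔ ((i * (j + 1)) % 2 ≡ 1 ⊎ m % 2 ≡ 0))
    × (FiniteField2.NoRootInμ F m (FiniteField2.H-C F i j) ⇔ (((1 + i) * (1 + j)) % 2 ≡ 1 ⊎ m % 2 ≡ 0))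
lemma3p2 m i j _ _ _ F =
    no-root-criterion m (H-A i j) (i * j) 3∤1+|F| (H-A-root⇒cube-root m i j) (H-A≈0-at-cube-root i j)
  , no-root-criterion m (H-B i j) (i * (j + 1)) 3∤1+|F| (H-B-root⇒cube-root m i j) (H-B≈0-at-cube-root i j)
  , no-root-criterion m (H-C i j) ((1 + i) * (1 + j)) 3∤1+|F|
      (H-C-root⇒cube-root m i j) (H-C≈0-at-cube-root i j)
  where
  open FiniteField2 F using (H-A; H-B; H-C)
  open Field F
  3∤1+|F| : ¬ 3 ∣ 1 + 2 ^ (2 * m)
  3∤1+|F| = 3∤1+2^[2m] m
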